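{- For every unsatisfiable clause-set $F$ and every partial assignment $\varphi$ we have $\mathrm{ss}(\varphi*F)\le\mathrm{ss}(F)$.
   Context: Clauses are finite sets of literals without complementary pair; clause-sets are finite sets of clauses; $\top$ is the empty clause-set, $c(F)$ the number of clauses. A partial assignment $\varphi$ maps finitely many variables to $\{0,1\}$; $\varphi*F$ removes satisfied clauses and false literals. $F$ is satisfiable iff $\varphi*F=\top$ for some $\varphi$; $F\models G$ iff every $\varphi$ with $\varphi*F=\top$ has $\varphi*G=\top$. Semantic $k$-sequence for $F$: $F_1,\dots,F_p$ with $c(F_i)\le k$, $F_1=\top$, and for $i\ge 2$ either $F_{i-1}\models F_i$ or $F_i=F_{i-1}\cup\{C\}$ for some $C\in F$; complete if $F_p$ is unsatisfiable. For unsatisfiable $F$, $\mathrm{ss}(F)$ is the least $k\in\mathbb{N}$ admitting a complete semantic $k$-sequence for $F$. -}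

module Defs where

open import Data.Nat using (ℕ; _<_; _≤_)
open import Data.Nat.Properties using () renaming (_≟_ to _≟ℕ_)
open import Data.Bool using (Bool; true; false; not; _∧_; _∨_; if_then_else_)
open import Data.Bool.Properties using () renaming (_≟_ to _≟B_)
open import Data.Maybe using (Maybe; just; nothing)
open import Data.Product using (_×_; _,_; proj₁; proj₂; Σ; ∃)
import Data.Product.Properties as ProdP
open import Data.Sum using (_⊎_)
open import Data.List using (List; []; _∷_; length; filter; map; deduplicate)
open import Data.Bool.ListAction using (any)
import Data.List.Properties as ListP
open import Data.List.Membership.Propositional using (_∈_)
open import Data.List.Relation.Unary.All using (All)
open import Data.List.Relation.Unary.Linked using (Linked)
open import Data.List.Relation.Unary.Unique.Propositional using (Unique)
open import Relation.Binary.PropositionalEquality using (_≡_)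
open import Relation.Binary.Definitions using (DecidableEquality)
open import Relation.Nullary using (¬_; Dec; yes; no)
open import Relation.Nullary.Decidable using (⌊_⌋)
open import Function.Bundles using (_⇔_)

-- Variables are natural numbers.  A literal is a pair (v , b):
-- (v , true) is the positive literal v, (v , false) is ¬v.

Var : Set
Var = ℕ

Literal : Set
Literal = Var × Bool

-- A clause is represented by the list of its literals, strictly sorted by
-- variable.  This is a canonical representation of a finite set of
-- literals without complementary pair (each variable occurs at most once),
-- so equality of clauses is propositional equality _≡_.
Clause : Set
Clause = List Literal

IsClause : Clause → Set
IsClause C = Linked (λ l l′ → proj₁ l < proj₁ l′) C

_≟C_ : DecidableEquality Clause
_≟C_ = ListP.≡-dec (ProdP.≡-dec _≟ℕ_ _≟B_)

-- A clause-set is a duplicate-free list of clauses (a finite set of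
-- clauses); c(F) is then its length.
IsClauseSet : List Clause → Set
IsClauseSet F = All IsClause F × Unique F

c : List Clause → ℕ
c F = length F

⊤ₛ : List Clause
⊤ₛ = []

-- Partial assignments: finite lists of variable/value pairs, read as a
-- finite partial map (first binding wins).  Every finite partial map
-- arises this way.

PAss : Set
PAss = List (Var × Bool)

lookupA : PAss → Var → Maybe Bool
lookupA []            v = nothing
lookupA ((w , b) ∷ φ) v = if ⌊ w ≟ℕ v ⌋ then just b else lookupA φ v

litTrue : PAss → Literal → Bool
litTrue φ (v , b) with lookupA φ v
... | just b′ = ⌊ b′ ≟B b ⌋
... | nothing = false

litFalse : PAss → Literal → Bool
litFalse φ (v , b) with lookupA φ v
... | just b′ = not ⌊ b′ ≟B b ⌋
... | nothing = false

satisfiedBy : PAss → Clause → Bool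
satisfiedBy φ C = any (litTrue φ) C

reduceC : PAss → Clause → Clause
reduceC φ C = filter (λ l → Relation.Nullary.Decidable.¬? (Data.Bool.T? (litFalse φ l))) C
  where import Data.Bool

_*_ : PAss → List Clause → List Clause
φ * F = deduplicate _≟C_
          (map (reduceC φ)
            (filter (λ C → Data.Bool.T? (not (satisfiedBy φ C))) F))
  where import Data.Bool

Satisfiable : List Clause → Set
Satisfiable F = ∃ λ (φ : PAss) → φ * F ≡ ⊤ₛ

Unsatisfiable : List Clause → Set
Unsatisfiable F = ¬ Satisfiable F

_⊨_ : List Clause → List Clause → Set
F ⊨ G = ∀ (φ : PAss) → φ * F ≡ ⊤ₛ → φ * G ≡ ⊤ₛ

_≈ₛ_ : List Clause → List Clause → Set
F ≈ₛ G = ∀ D → (D ∈ F) ⇔ (D ∈ G)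

Step : List Clause → List Clause → List Clause → Set
Step F G H = (G ⊨ H) ⊎ (Σ Clause λ C → (C ∈ F) × (H ≈ₛ (C ∷ G)))

-- SeqFrom F k G H : a sequence G = F_i , ... , F_p = H of clause-sets,
-- each with at most k clauses (from the second element on; the first is
-- checked by the caller), consecutive elements related by Step F.
data SeqFrom (F : List Clause) (k : ℕ) : List Clause → List Clause → Set where
  done : ∀ {G} → SeqFrom F k G G
  step : ∀ {G H K} → IsClauseSet H → c H ≤ k → Step F G H →
         SeqFrom F k H K → SeqFrom F k G K

CompleteSemSeq : List Clause → ℕ → Set
CompleteSemSeq F k = Σ (List Clause) λ Fp → SeqFrom F k ⊤ₛ Fp × Unsatisfiable Fp

IsSS : List Clause → ℕ → Set
IsSS F k = CompleteSemSeq F k × (∀ k′ → CompleteSemSeq F k′ → k ≤ k′)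

-- Applying φ to every clause-set of a complete semantic k-sequence for F gives one for φ * F:
-- θ satisfies φ * G exactly when φ ++ θ (φ, then θ) satisfies G, so entailment steps and the
-- unsatisfiability of the last clause-set survive; adding an axiom C becomes adding the reduct
-- of C, or a trivial entailment when φ satisfies C; and c never grows.  Because ss is a least
-- element, the existence of a complete j-sequence must moreover be decidable.  Setting to false
-- every variable that is foreign to G projects a complete sequence for G onto one whose
-- clause-sets are over the variables of G, and among the finitely many such clause-sets with at
-- most j clauses reachability is decidable.

module Submission where

open import Defs
open import Data.Bool using (true; false; not; T; T?; _∨_)
open import Data.Bool.Properties using () renaming (_≟_ to _≟B_)
open import Data.Empty using (⊥-elim)
open import Data.List using (List; []; _∷_; _++_; map; filter; concatMap; length; deduplicate; cartesianProduct)
open import Data.List.Extrema.Nat using (max; xs≤max)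
open import Data.List.Membership.Propositional using (_∈_; _∉_; find; lose)
open import Data.List.Membership.Propositional.Properties
  using ( ∈-filter⁺; ∈-filter⁻; ∈-map⁺; ∈-map⁻; ∈-cartesianProduct⁺; ∈-concatMap⁺; ∈-++⁺ˡ; ∈-++⁺ʳ
        ; ∈-map∘filter⁺; ∈-map∘filter⁻; ∈-deduplicate⁺; ∈-deduplicate⁻ )
import Data.List.Properties as List
open import Data.List.Properties using (length-map; length-filter; length-deduplicate; filter-all)
open import Data.List.Relation.Binary.Subset.DecPropositional _≟C_ using (_⊆?_)
open import Data.List.Relation.Binary.Subset.Propositional using (_⊆_)
open import Data.List.Relation.Unary.All as All using (All; _∷_)
import Data.List.Relation.Unary.AllPairs as AllPairs
open import Data.List.Relation.Unary.Any as Any using (Any; here; there)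
open import Data.List.Relation.Unary.Any.Properties using (any⁺; any⁻)
open import Data.List.Relation.Unary.Linked as Linked using (Linked)
import Data.List.Relation.Unary.Linked.Properties as Linkedₚ
open import Data.List.Relation.Unary.Unique.DecPropositional _≟C_ using (unique?)
open import Data.List.Relation.Unary.Unique.DecPropositional.Properties _≟C_ using (deduplicate-!)
open import Data.Maybe using (just; nothing; maybe′; _<∣>_)
open import Data.Nat using (ℕ; zero; suc; _≤_; _<_; _∸_; z≤n; s≤s; s≤s⁻¹)
open import Data.Nat.Properties
  using ( _<?_; _≤?_; ≤-refl; ≤-trans; <-trans; <-≤-trans; n<1+n; ≮⇒≥; m≤n⇒m≤1+n; m<n⇒m<1+n
        ; m<1+n⇒m<n∨m≡n; +-∸-assoc; ∸-monoʳ-≤; module ≤-Reasoning )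
  renaming (_≟_ to _≟ℕ_)
open import Data.List.Membership.DecPropositional _≟ℕ_ using () renaming (_∈?_ to _∈ℕ?_)
open import Data.Product using (Σ; ∃; _×_; _,_; proj₁; proj₂)
open import Data.Sum using (_⊎_; inj₁; inj₂; [_,_]′)
open import Data.Unit using (⊤; tt)
open import Function using (case_of_; _∘_; id)
open import Function.Bundles using (_⇔_; mk⇔; Equivalence)
open import Function.Properties.Equivalence using (⇔-setoid)
open import Level using (0ℓ)
open import Relation.Binary.Construct.Closure.ReflexiveTransitive using (Star; ε; _◅_; _◅◅_)
open import Relation.Binary.Definitions using (DecidableEquality)
open import Relation.Binary.PropositionalEquality using (_≡_; refl; sym; trans; cong₂; subst)
import Relation.Binary.Reasoning.Setoid as ≈-Reasoning
open import Relation.Nullary using (¬_; Dec; yes; no; contradiction)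
open import Relation.Nullary.Decidable using (⌊_⌋; ¬?; map′; _×-dec_; _⊎-dec_; _→-dec_)
open import Relation.Unary using (Decidable)


open Equivalence using (to; from)

T-not⁺ : ∀ {b} → ¬ T b → T (not b)
T-not⁺ {false} _ = tt
T-not⁺ {true}  f = f tt

T-not⁻ : ∀ {b} → T (not b) → ¬ T b
T-not⁻ {false} _ ()

litTrue-lookupA : ∀ φ v b → litTrue φ (v , b) ≡ maybe′ (λ b′ → ⌊ b′ ≟B b ⌋) false (lookupA φ v)
litTrue-lookupA φ v b with lookupA φ v
... | just _  = refl
... | nothing = refl

litFalse-lookupA : ∀ φ v b → litFalse φ (v , b) ≡ maybe′ (λ b′ → not ⌊ b′ ≟B b ⌋) false (lookupA φ v)
litFalse-lookupA φ v b with lookupA φ v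
... | just _  = refl
... | nothing = refl

lookupA-++ : ∀ ψ θ v → lookupA (ψ ++ θ) v ≡ (lookupA ψ v <∣> lookupA θ v)
lookupA-++ []            θ v = refl
lookupA-++ ((w , b) ∷ ψ) θ v with w ≟ℕ v
... | yes _ = refl
... | no  _ = lookupA-++ ψ θ v

-- lookupA takes the first binding, so in ψ ++ θ the assignment ψ takes precedence.
litTrue-++ : ∀ ψ θ l →
  T (litTrue (ψ ++ θ) l) ⇔ (T (litTrue ψ l) ⊎ (¬ T (litFalse ψ l) × T (litTrue θ l)))
litTrue-++ ψ θ (v , b)
  rewrite litTrue-lookupA (ψ ++ θ) v b | lookupA-++ ψ θ v
        | litTrue-lookupA ψ v b | litFalse-lookupA ψ v b | litTrue-lookupA θ v b
  with lookupA ψ v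
... | nothing = mk⇔ (λ t → inj₂ ((λ ()) , t)) λ { (inj₁ ()) ; (inj₂ (_ , t)) → t }
... | just b′ with b′ ≟B b
...   | yes _ = mk⇔ inj₁ (λ _ → tt)
...   | no  _ = mk⇔ (λ ()) λ { (inj₁ ()) ; (inj₂ (notFalse , _)) → ⊥-elim (notFalse tt) }

litTrue-cong : ∀ φ θ l → lookupA φ (proj₁ l) ≡ lookupA θ (proj₁ l) → litTrue φ l ≡ litTrue θ l
litTrue-cong φ θ (v , b) eq rewrite litTrue-lookupA φ v b | litTrue-lookupA θ v b | eq = refl

satisfiedBy-cong : ∀ φ θ C → (∀ {l} → l ∈ C → lookupA φ (proj₁ l) ≡ lookupA θ (proj₁ l)) →
  satisfiedBy φ C ≡ satisfiedBy θ C
satisfiedBy-cong φ θ []      agree = refl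
satisfiedBy-cong φ θ (l ∷ C) agree =
  cong₂ _∨_ (litTrue-cong φ θ l (agree (here refl))) (satisfiedBy-cong φ θ C (λ l∈C → agree (there l∈C)))

∈-reduceC⁺ : ∀ φ {C l} → l ∈ C → ¬ T (litFalse φ l) → l ∈ reduceC φ C
∈-reduceC⁺ φ = ∈-filter⁺ (λ l → ¬? (T? (litFalse φ l)))

∈-reduceC⁻ : ∀ φ C {l} → l ∈ reduceC φ C → l ∈ C × ¬ T (litFalse φ l)
∈-reduceC⁻ φ C = ∈-filter⁻ (λ l → ¬? (T? (litFalse φ l)))

satisfiedBy-++ : ∀ ψ θ C →
  T (satisfiedBy (ψ ++ θ) C) ⇔ (T (satisfiedBy ψ C) ⊎ T (satisfiedBy θ (reduceC ψ C)))
satisfiedBy-++ ψ θ C = mk⇔ split join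
  where
  split : T (satisfiedBy (ψ ++ θ) C) → T (satisfiedBy ψ C) ⊎ T (satisfiedBy θ (reduceC ψ C))
  split sat with find (any⁻ (litTrue (ψ ++ θ)) C sat)
  ... | l , l∈C , t with to (litTrue-++ ψ θ l) t
  ...   | inj₁ tψ             = inj₁ (any⁺ (litTrue ψ) (lose l∈C tψ))
  ...   | inj₂ (notFalse , tθ) = inj₂ (any⁺ (litTrue θ) (lose (∈-reduceC⁺ ψ l∈C notFalse) tθ))

  join : T (satisfiedBy ψ C) ⊎ T (satisfiedBy θ (reduceC ψ C)) → T (satisfiedBy (ψ ++ θ) C)
  join (inj₁ sat) with find (any⁻ (litTrue ψ) C sat)
  ... | l , l∈C , tψ = any⁺ (litTrue (ψ ++ θ)) (lose l∈C (from (litTrue-++ ψ θ l) (inj₁ tψ)))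
  join (inj₂ sat) with find (any⁻ (litTrue θ) (reduceC ψ C) sat)
  ... | l , l∈ψC , tθ with ∈-reduceC⁻ ψ C l∈ψC
  ...   | l∈C , notFalse = any⁺ (litTrue (ψ ++ θ)) (lose l∈C (from (litTrue-++ ψ θ l) (inj₂ (notFalse , tθ))))

∈-*⁺ : ∀ φ F {C} → C ∈ F → ¬ T (satisfiedBy φ C) → reduceC φ C ∈ φ * F
∈-*⁺ φ F {C} C∈F unsat = ∈-deduplicate⁺ _≟C_
  (∈-map∘filter⁺ (reduceC φ) (λ C → T? (not (satisfiedBy φ C))) (C , C∈F , refl , T-not⁺ unsat))

∈-*⁻ : ∀ φ F {D} → D ∈ φ * F → ∃ λ C → C ∈ F × ¬ T (satisfiedBy φ C) × D ≡ reduceC φ C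
∈-*⁻ φ F D∈φF with ∈-map∘filter⁻ (reduceC φ) (λ C → T? (not (satisfiedBy φ C))) (∈-deduplicate⁻ _≟C_ _ D∈φF)
... | C , C∈F , D≡ , t = C , C∈F , T-not⁻ t , D≡

Satisfies : PAss → List Clause → Set
Satisfies φ F = ∀ {C} → C ∈ F → T (satisfiedBy φ C)

*-≡⊤ₛ⇔Satisfies : ∀ φ F → (φ * F ≡ ⊤ₛ) ⇔ Satisfies φ F
*-≡⊤ₛ⇔Satisfies φ F = mk⇔ satisfies empty
  where
  satisfies : φ * F ≡ ⊤ₛ → Satisfies φ F
  satisfies eq {C} C∈F with T? (satisfiedBy φ C)
  ... | yes sat  = sat
  ... | no unsat = case subst (reduceC φ C ∈_) eq (∈-*⁺ φ F C∈F unsat) of λ ()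

  empty : Satisfies φ F → φ * F ≡ ⊤ₛ
  empty sat with φ * F in eq
  ... | []    = refl
  ... | D ∷ _ with ∈-*⁻ φ F (subst (D ∈_) (sym eq) (here refl))
  ...   | C , C∈F , unsat , _ = ⊥-elim (unsat (sat C∈F))

Satisfies-* : ∀ ψ θ F → Satisfies θ (ψ * F) ⇔ Satisfies (ψ ++ θ) F
Satisfies-* ψ θ F = mk⇔ forward backward
  where
  forward : Satisfies θ (ψ * F) → Satisfies (ψ ++ θ) F
  forward sat {C} C∈F with T? (satisfiedBy ψ C)
  ... | yes satψ = from (satisfiedBy-++ ψ θ C) (inj₁ satψ)
  ... | no unsat = from (satisfiedBy-++ ψ θ C) (inj₂ (sat (∈-*⁺ ψ F C∈F unsat)))

  backward : Satisfies (ψ ++ θ) F → Satisfies θ (ψ * F)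
  backward sat D∈ψF with ∈-*⁻ ψ F D∈ψF
  ... | C , C∈F , unsat , refl with to (satisfiedBy-++ ψ θ C) (sat C∈F)
  ...   | inj₁ satψ = ⊥-elim (unsat satψ)
  ...   | inj₂ satθ = satθ

*-*-≡⊤ₛ : ∀ ψ θ F → (θ * (ψ * F) ≡ ⊤ₛ) ⇔ ((ψ ++ θ) * F ≡ ⊤ₛ)
*-*-≡⊤ₛ ψ θ F = begin
  θ * (ψ * F) ≡ ⊤ₛ     ≈⟨ *-≡⊤ₛ⇔Satisfies θ (ψ * F) ⟩
  Satisfies θ (ψ * F)  ≈⟨ Satisfies-* ψ θ F ⟩
  Satisfies (ψ ++ θ) F ≈⟨ *-≡⊤ₛ⇔Satisfies (ψ ++ θ) F ⟨
  (ψ ++ θ) * F ≡ ⊤ₛ    ∎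
  where open ≈-Reasoning (⇔-setoid 0ℓ)

*-⊨ : ∀ ψ G H → G ⊨ H → (ψ * G) ⊨ (ψ * H)
*-⊨ ψ G H G⊨H θ = from (*-*-≡⊤ₛ ψ θ H) ∘ G⊨H (ψ ++ θ) ∘ to (*-*-≡⊤ₛ ψ θ G)

*-unsatisfiable : ∀ ψ F → Unsatisfiable F → Unsatisfiable (ψ * F)
*-unsatisfiable ψ F unsat (θ , θψF≡⊤) = unsat (ψ ++ θ , to (*-*-≡⊤ₛ ψ θ F) θψF≡⊤)

⊆⇒⊨ : ∀ {G H} → H ⊆ G → G ⊨ H
⊆⇒⊨ {G} {H} H⊆G θ θG≡⊤ = from (*-≡⊤ₛ⇔Satisfies θ H) (to (*-≡⊤ₛ⇔Satisfies θ G) θG≡⊤ ∘ H⊆G)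

IsClauseSet-* : ∀ φ {F} → IsClauseSet F → IsClauseSet (φ * F)
IsClauseSet-* φ {F} (clauses , _) = All.tabulate isClause , deduplicate-! _
  where
  isClause : ∀ {D} → D ∈ φ * F → IsClause D
  isClause D∈φF with ∈-*⁻ φ F D∈φF
  ... | C , C∈F , _ , refl = Linkedₚ.filter⁺ (λ l → ¬? (T? (litFalse φ l))) <-trans (All.lookup clauses C∈F)

c-*-≤ : ∀ φ F → c (φ * F) ≤ c F
c-*-≤ φ F = begin
  length (deduplicate _≟C_ (map (reduceC φ) unsat))  ≤⟨ length-deduplicate _≟C_ (map (reduceC φ) unsat) ⟩
  length (map (reduceC φ) unsat)                     ≡⟨ length-map (reduceC φ) unsat ⟩
  length unsat                                       ≤⟨ length-filter (λ C → T? (not (satisfiedBy φ C))) F ⟩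
  length F                                           ∎
  where
  open ≤-Reasoning
  unsat = filter (λ C → T? (not (satisfiedBy φ C))) F

AllStates : ∀ {F k G K} → (List Clause → Set) → SeqFrom F k G K → Set
AllStates P done                    = ⊤
AllStates P (step {H = H} _ _ _ s) = P H × AllStates P s

module _ (ψ : PAss) {F F′ : List Clause}
         (reduceC-∈ : ∀ {C} → C ∈ F → ¬ T (satisfiedBy ψ C) → reduceC ψ C ∈ F′) where

  Step-* : ∀ {G H} → Step F G H → Step F′ (ψ * G) (ψ * H)
  Step-* {G} {H} (inj₁ G⊨H) = inj₁ (*-⊨ ψ G H G⊨H)
  Step-* {G} {H} (inj₂ (C , C∈F , H≈C∷G)) with T? (satisfiedBy ψ C)
  ... | yes sat = inj₁ (⊆⇒⊨ ψH⊆ψG)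
    where
    ψH⊆ψG : ψ * H ⊆ ψ * G
    ψH⊆ψG D∈ψH with ∈-*⁻ ψ H D∈ψH
    ... | C′ , C′∈H , unsat , refl with to (H≈C∷G C′) C′∈H
    ...   | here refl = ⊥-elim (unsat sat)
    ...   | there C′∈G = ∈-*⁺ ψ G C′∈G unsat
  ... | no unsat = inj₂ (reduceC ψ C , reduceC-∈ C∈F unsat , λ D → mk⇔ (forward D) (backward D))
    where
    forward : ∀ D → D ∈ ψ * H → D ∈ reduceC ψ C ∷ ψ * G
    forward D D∈ψH with ∈-*⁻ ψ H D∈ψH
    ... | C′ , C′∈H , unsat′ , refl with to (H≈C∷G C′) C′∈H
    ...   | here refl  = here refl
    ...   | there C′∈G = there (∈-*⁺ ψ G C′∈G unsat′)

    backward : ∀ D → D ∈ reduceC ψ C ∷ ψ * G → D ∈ ψ * H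
    backward D (here refl) = ∈-*⁺ ψ H (from (H≈C∷G C) (here refl)) unsat
    backward D (there D∈ψG) with ∈-*⁻ ψ G D∈ψG
    ... | C′ , C′∈G , unsat′ , refl = ∈-*⁺ ψ H (from (H≈C∷G C′) (there C′∈G)) unsat′

  SeqFrom-* : ∀ {k G K} → SeqFrom F k G K → SeqFrom F′ k (ψ * G) (ψ * K)
  SeqFrom-* done = done
  SeqFrom-* (step {H = H} isH cH≤k G→H s) =
    step (IsClauseSet-* ψ isH) (≤-trans (c-*-≤ ψ H) cH≤k) (Step-* G→H) (SeqFrom-* s)

  AllStates-SeqFrom-* : ∀ {P Q : List Clause → Set} → (∀ {H} → P H → Q (ψ * H)) →
                        ∀ {k G K} (s : SeqFrom F k G K) → AllStates P s → AllStates Q (SeqFrom-* s)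
  AllStates-SeqFrom-* P⇒Q done           tt           = tt
  AllStates-SeqFrom-* P⇒Q (step _ _ _ s) (pH , pRest) = P⇒Q pH , AllStates-SeqFrom-* P⇒Q s pRest

CompleteSemSeq-* : ∀ φ {F k} → CompleteSemSeq F k → CompleteSemSeq (φ * F) k
CompleteSemSeq-* φ {F} (Fp , s , unsat) = φ * Fp , SeqFrom-* φ (∈-*⁺ φ F) s , *-unsatisfiable φ Fp unsat

infix 4 _≟ₛ_

_≟ₛ_ : (F G : List Clause) → Dec (F ≡ G)
_≟ₛ_ = List.≡-dec _≟C_

vars : List Clause → List Var
vars F = concatMap (map proj₁) F

Over : List Var → List Clause → Set
Over V F = ∀ {C} → C ∈ F → ∀ {l} → l ∈ C → proj₁ l ∈ V

Over-vars : ∀ F → Over (vars F) F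
Over-vars F C∈F l∈C = ∈-concatMap⁺ (map proj₁) (lose C∈F (∈-map⁺ proj₁ l∈C))

Over-mono : ∀ {V W F} → V ⊆ W → Over V F → Over W F
Over-mono V⊆W over C∈F l∈C = V⊆W (over C∈F l∈C)

restrict : PAss → List Var → PAss
restrict φ []      = []
restrict φ (v ∷ V) with lookupA φ v
... | just b  = (v , b) ∷ restrict φ V
... | nothing = restrict φ V

lookupA-restrict-∉ : ∀ φ {V v} → v ∉ V → lookupA (restrict φ V) v ≡ nothing
lookupA-restrict-∉ φ {[]}    v∉V = refl
lookupA-restrict-∉ φ {w ∷ V} {v} v∉w∷V with lookupA φ w
... | nothing = lookupA-restrict-∉ φ (v∉w∷V ∘ there)
... | just b with w ≟ℕ v
...   | yes refl = ⊥-elim (v∉w∷V (here refl))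
...   | no  _    = lookupA-restrict-∉ φ (v∉w∷V ∘ there)

lookupA-restrict-∈ : ∀ φ {V v} → v ∈ V → lookupA (restrict φ V) v ≡ lookupA φ v
lookupA-restrict-∈ φ {w ∷ V} {v} v∈w∷V with lookupA φ w in eq
... | just b with w ≟ℕ v
...   | yes refl = sym eq
...   | no  w≢v  = lookupA-restrict-∈ φ (Any.tail (w≢v ∘ sym) v∈w∷V)
lookupA-restrict-∈ φ {w ∷ V} {v} v∈w∷V | nothing with v ∈ℕ? V | v∈w∷V
... | yes v∈V | _         = lookupA-restrict-∈ φ v∈V
... | no  v∉V | here refl = trans (lookupA-restrict-∉ φ v∉V) (sym eq)
... | no  v∉V | there v∈V = ⊥-elim (v∉V v∈V)

branch : Var → PAss → List PAss
branch v θ = θ ∷ ((v , true) ∷ θ) ∷ ((v , false) ∷ θ) ∷ []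

assignmentsOver : List Var → List PAss
assignmentsOver []      = [] ∷ []
assignmentsOver (v ∷ V) = concatMap (branch v) (assignmentsOver V)

restrict-∈ : ∀ φ V → restrict φ V ∈ assignmentsOver V
restrict-∈ φ []      = here refl
restrict-∈ φ (v ∷ V) with lookupA φ v
... | nothing    = ∈-concatMap⁺ (branch v) (lose (restrict-∈ φ V) (here refl))
... | just true  = ∈-concatMap⁺ (branch v) (lose (restrict-∈ φ V) (there (here refl)))
... | just false = ∈-concatMap⁺ (branch v) (lose (restrict-∈ φ V) (there (there (here refl))))

*-≡⊤ₛ-restrict : ∀ φ V F → Over V F → (φ * F ≡ ⊤ₛ) ⇔ (restrict φ V * F ≡ ⊤ₛ)
*-≡⊤ₛ-restrict φ V F over = begin
  φ * F ≡ ⊤ₛ                ≈⟨ *-≡⊤ₛ⇔Satisfies φ F ⟩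
  Satisfies φ F              ≈⟨ mk⇔ (λ sat {C} C∈F → subst T (agree C∈F) (sat C∈F))
                                    (λ sat {C} C∈F → subst T (sym (agree C∈F)) (sat C∈F)) ⟩
  Satisfies (restrict φ V) F ≈⟨ *-≡⊤ₛ⇔Satisfies (restrict φ V) F ⟨
  restrict φ V * F ≡ ⊤ₛ     ∎
  where
  open ≈-Reasoning (⇔-setoid 0ℓ)
  agree : ∀ {C} → C ∈ F → satisfiedBy φ C ≡ satisfiedBy (restrict φ V) C
  agree {C} C∈F = satisfiedBy-cong φ (restrict φ V) C (λ l∈C → sym (lookupA-restrict-∈ φ (over C∈F l∈C)))

satisfiable? : ∀ F → Dec (Satisfiable F)
satisfiable? F = map′ witness search (Any.any? (λ θ → θ * F ≟ₛ ⊤ₛ) (assignmentsOver (vars F)))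
  where
  witness : Any (λ θ → θ * F ≡ ⊤ₛ) (assignmentsOver (vars F)) → Satisfiable F
  witness sat with find sat
  ... | θ , _ , θF≡⊤ = θ , θF≡⊤

  search : Satisfiable F → Any (λ θ → θ * F ≡ ⊤ₛ) (assignmentsOver (vars F))
  search (φ , φF≡⊤) = lose (restrict-∈ φ (vars F)) (to (*-≡⊤ₛ-restrict φ (vars F) F (Over-vars F)) φF≡⊤)

⊨? : ∀ G H → Dec (G ⊨ H)
⊨? G H = map′ sound complete (All.all? (λ θ → θ * G ≟ₛ ⊤ₛ →-dec θ * H ≟ₛ ⊤ₛ) (assignmentsOver V))
  where
  V = vars G ++ vars H
  restrictG : ∀ φ → (φ * G ≡ ⊤ₛ) ⇔ (restrict φ V * G ≡ ⊤ₛ)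
  restrictG φ = *-≡⊤ₛ-restrict φ V G (Over-mono ∈-++⁺ˡ (Over-vars G))

  restrictH : ∀ φ → (φ * H ≡ ⊤ₛ) ⇔ (restrict φ V * H ≡ ⊤ₛ)
  restrictH φ = *-≡⊤ₛ-restrict φ V H (Over-mono (∈-++⁺ʳ (vars G)) (Over-vars H))

  sound : All (λ θ → θ * G ≡ ⊤ₛ → θ * H ≡ ⊤ₛ) (assignmentsOver V) → G ⊨ H
  sound entails φ = from (restrictH φ) ∘ All.lookup entails (restrict-∈ φ V) ∘ to (restrictG φ)

  complete : G ⊨ H → All (λ θ → θ * G ≡ ⊤ₛ → θ * H ≡ ⊤ₛ) (assignmentsOver V)
  complete G⊨H = All.tabulate (λ {θ} _ → G⊨H θ)

≈ₛ? : ∀ G H → Dec (G ≈ₛ H)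
≈ₛ? G H = map′ fromSubsets (λ G≈H → to (G≈H _) , from (G≈H _)) (G ⊆? H ×-dec H ⊆? G)
  where
  fromSubsets : G ⊆ H × H ⊆ G → G ≈ₛ H
  fromSubsets (G⊆H , H⊆G) D = mk⇔ G⊆H H⊆G

Step? : ∀ F G H → Dec (Step F G H)
Step? F G H = ⊨? G H ⊎-dec map′ find (λ (C , C∈F , H≈C∷G) → lose C∈F H≈C∷G) (Any.any? (λ C → ≈ₛ? H (C ∷ G)) F)

IsClauseSet? : ∀ F → Dec (IsClauseSet F)
IsClauseSet? F = All.all? (Linked.linked? (λ l l′ → proj₁ l <? proj₁ l′)) F ×-dec unique? F

SemStep : List Clause → ℕ → List Clause → List Clause → Set
SemStep F k G H = IsClauseSet H × c H ≤ k × Step F G H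

SemStep? : ∀ F k G H → Dec (SemStep F k G H)
SemStep? F k G H = IsClauseSet? H ×-dec c H ≤? k ×-dec Step? F G H

-- Projection onto a set of variables

assigned⇒litTrue⊎litFalse : ∀ φ l {b} → lookupA φ (proj₁ l) ≡ just b → T (litTrue φ l) ⊎ T (litFalse φ l)
assigned⇒litTrue⊎litFalse φ (v , b′) {b} eq
  rewrite litTrue-lookupA φ v b′ | litFalse-lookupA φ v b′ | eq with b ≟B b′
... | yes _ = inj₁ tt
... | no  _ = inj₂ tt

unassigned⇒¬litFalse : ∀ φ l → lookupA φ (proj₁ l) ≡ nothing → ¬ T (litFalse φ l)
unassigned⇒¬litFalse φ (v , b) eq rewrite litFalse-lookupA φ v b | eq = λ ()

falsify : List Var → PAss
falsify U = map (_, false) U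

lookupA-falsify-∈ : ∀ {U v} → v ∈ U → lookupA (falsify U) v ≡ just false
lookupA-falsify-∈ {w ∷ U} {v} v∈w∷U with w ≟ℕ v
... | yes _   = refl
... | no  w≢v = lookupA-falsify-∈ (Any.tail (w≢v ∘ sym) v∈w∷U)

lookupA-falsify-∉ : ∀ {U v} → v ∉ U → lookupA (falsify U) v ≡ nothing
lookupA-falsify-∉ {[]}    v∉U = refl
lookupA-falsify-∉ {w ∷ U} {v} v∉w∷U with w ≟ℕ v
... | yes refl = ⊥-elim (v∉w∷U (here refl))
... | no  _    = lookupA-falsify-∉ (v∉w∷U ∘ there)

varsSeq : ∀ {F k G K} → SeqFrom F k G K → List Var
varsSeq done                    = []
varsSeq (step {H = H} _ _ _ s) = vars H ++ varsSeq s

AllStates-Over : ∀ {F k G K} (s : SeqFrom F k G K) {W} → varsSeq s ⊆ W → AllStates (Over W) s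
AllStates-Over done                    _ = tt
AllStates-Over (step {H = H} _ _ _ s) ⊆W =
  Over-mono (⊆W ∘ ∈-++⁺ˡ) (Over-vars H) , AllStates-Over s (⊆W ∘ ∈-++⁺ʳ (vars H))

module Projection (V W : List Var) where

  outside : List Var
  outside = filter (λ v → ¬? (v ∈ℕ? V)) W

  ψ : PAss
  ψ = falsify outside

  reduceC-Over : ∀ {C} → (∀ {l} → l ∈ C → proj₁ l ∈ V) → reduceC ψ C ≡ C
  reduceC-Over over = filter-all (λ l → ¬? (T? (litFalse ψ l))) (All.tabulate notFalse)
    where
    notFalse : ∀ {l} → l ∈ _ → ¬ T (litFalse ψ l)
    notFalse {l} l∈C = unassigned⇒¬litFalse ψ l
      (lookupA-falsify-∉ {outside} λ v∈outside →
         proj₂ (∈-filter⁻ (λ v → ¬? (v ∈ℕ? V)) {xs = W} v∈outside) (over l∈C))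

  *-Over : ∀ {H} → Over W H → Over V (ψ * H)
  *-Over {H} overW D∈ψH {l} l∈D with ∈-*⁻ ψ H D∈ψH
  ... | C , C∈H , unsat , refl with ∈-reduceC⁻ ψ C l∈D
  ...   | l∈C , notFalse with proj₁ l ∈ℕ? V
  ...     | yes v∈V = v∈V
  ...     | no  v∉V with assigned⇒litTrue⊎litFalse ψ l
                           (lookupA-falsify-∈ (∈-filter⁺ (λ v → ¬? (v ∈ℕ? V)) (overW C∈H l∈C) v∉V))
  ...       | inj₁ isTrue  = ⊥-elim (unsat (any⁺ (litTrue ψ) (lose l∈C isTrue)))
  ...       | inj₂ isFalse = ⊥-elim (notFalse isFalse)

projectOnto : ∀ V {F k K} → Over V F → SeqFrom F k ⊤ₛ K → Unsatisfiable K →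
  Σ (List Clause) λ K′ → Σ (SeqFrom F k ⊤ₛ K′) λ s′ → AllStates (Over V) s′ × Unsatisfiable K′
projectOnto V {F} {K = K} overF s unsat =
  ψ * K , SeqFrom-* ψ reduceC-∈ s , AllStates-SeqFrom-* ψ reduceC-∈ *-Over s (AllStates-Over s id)
        , *-unsatisfiable ψ K unsat
  where
  open Projection V (varsSeq s)
  reduceC-∈ : ∀ {C} → C ∈ F → ¬ T (satisfiedBy ψ C) → reduceC ψ C ∈ F
  reduceC-∈ C∈F _ = subst (_∈ F) (sym (reduceC-Over (overF C∈F))) C∈F

-- Finitely many clause-sets over finitely many variables

boundedLists : ∀ {A : Set} → List A → ℕ → List (List A)
boundedLists U zero    = [] ∷ []
boundedLists U (suc n) = [] ∷ concatMap (λ x → map (x ∷_) (boundedLists U n)) U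

∈-boundedLists : ∀ {A : Set} {U : List A} n {xs} → length xs ≤ n → xs ⊆ U → xs ∈ boundedLists U n
∈-boundedLists zero    {[]} _ _ = here refl
∈-boundedLists (suc n) {[]} _ _ = here refl
∈-boundedLists {U = U} (suc n) {x ∷ xs} (s≤s len≤n) ⊆U =
  there (∈-concatMap⁺ (λ y → map (y ∷_) (boundedLists U n))
          (lose (⊆U (here refl)) (∈-map⁺ (x ∷_) (∈-boundedLists n len≤n (⊆U ∘ there)))))

length-increasing-≤ : ∀ {m M xs} → Linked _<_ xs → All (m ≤_) xs → All (_< M) xs → length xs ≤ M ∸ m
length-increasing-≤ {xs = []} _ _ _ = z≤n
length-increasing-≤ {m} {M} {x ∷ xs} increasing (m≤x ∷ _) (x<M ∷ below) = begin
  suc (length xs) ≤⟨ s≤s (length-increasing-≤ (Linked.tail increasing) aboveX below) ⟩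
  suc (M ∸ suc x) ≡⟨ +-∸-assoc 1 x<M ⟨
  M ∸ x           ≤⟨ ∸-monoʳ-≤ M m≤x ⟩
  M ∸ m           ∎
  where
  open ≤-Reasoning
  aboveX : All (suc x ≤_) xs
  aboveX = AllPairs.head (Linkedₚ.Linked⇒AllPairs <-trans increasing)

literalsOver : List Var → List Literal
literalsOver V = cartesianProduct V (true ∷ false ∷ [])

-- a clause over V is strictly sorted by variables, all of them at most max 0 V
clausesOver : List Var → List Clause
clausesOver V = boundedLists (literalsOver V) (suc (max 0 V))

∈-clausesOver : ∀ {V C} → IsClause C → (∀ {l} → l ∈ C → proj₁ l ∈ V) → C ∈ clausesOver V
∈-clausesOver {V} {C} sorted over = ∈-boundedLists (suc (max 0 V)) length≤ (λ l∈C → ∈-literalsOver (over l∈C))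
  where
  ∈-literalsOver : ∀ {v b} → v ∈ V → (v , b) ∈ literalsOver V
  ∈-literalsOver {b = true}  v∈V = ∈-cartesianProduct⁺ v∈V (here refl)
  ∈-literalsOver {b = false} v∈V = ∈-cartesianProduct⁺ v∈V (there (here refl))

  length≤ : length C ≤ suc (max 0 V)
  length≤ = begin
    length C              ≡⟨ length-map proj₁ C ⟨
    length (map proj₁ C)  ≤⟨ length-increasing-≤ (Linkedₚ.map⁺ sorted) (All.tabulate (λ _ → z≤n))
                                (All.tabulate (λ {v} v∈C → s≤s (All.lookup (xs≤max 0 V) (varIn v∈C)))) ⟩
    suc (max 0 V)         ∎
    where
    open ≤-Reasoning
    varIn : ∀ {v} → v ∈ map proj₁ C → v ∈ V
    varIn v∈ with ∈-map⁻ proj₁ v∈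
    ... | l , l∈C , refl = over l∈C

clauseSetsOver : List Var → ℕ → List (List Clause)
clauseSetsOver V k = boundedLists (clausesOver V) k

∈-clauseSetsOver : ∀ {V k F} → IsClauseSet F → c F ≤ k → Over V F → F ∈ clauseSetsOver V k
∈-clauseSetsOver {k = k} (clauses , _) cF≤k over =
  ∈-boundedLists k cF≤k (λ C∈F → ∈-clausesOver (All.lookup clauses C∈F) (over C∈F))

-- Reachability in a finite space

module _ {A : Set} {P Q : A → Set} (P? : Decidable P) (Q? : Decidable Q) (P⇒Q : ∀ {x} → P x → Q x) where

  length-filter-mono-≤ : ∀ xs → length (filter P? xs) ≤ length (filter Q? xs)
  length-filter-mono-≤ []       = z≤n
  length-filter-mono-≤ (x ∷ xs) with P? x | Q? x
  ... | yes _  | yes _  = s≤s (length-filter-mono-≤ xs)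
  ... | yes px | no ¬qx = contradiction (P⇒Q px) ¬qx
  ... | no  _  | yes _  = m≤n⇒m≤1+n (length-filter-mono-≤ xs)
  ... | no  _  | no  _  = length-filter-mono-≤ xs

  length-filter-mono-< : ∀ xs {y} → y ∈ xs → Q y → ¬ P y → length (filter P? xs) < length (filter Q? xs)
  length-filter-mono-< (x ∷ xs) (here refl) qx ¬px with P? x | Q? x
  ... | yes px | _      = contradiction px ¬px
  ... | no  _  | yes _  = s≤s (length-filter-mono-≤ xs)
  ... | no  _  | no ¬qx = contradiction qx ¬qx
  length-filter-mono-< (x ∷ xs) (there y∈xs) qy ¬py with P? x | Q? x
  ... | yes _  | yes _  = s≤s (length-filter-mono-< xs y∈xs qy ¬py)
  ... | yes px | no ¬qx = contradiction (P⇒Q px) ¬qx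
  ... | no  _  | yes _  = m<n⇒m<1+n (length-filter-mono-< xs y∈xs qy ¬py)
  ... | no  _  | no  _  = length-filter-mono-< xs y∈xs qy ¬py

module FiniteReachability {A : Set} (_≟_ : DecidableEquality A) (space : List A)
                          {_⟶_ : A → A → Set} (_⟶?_ : ∀ x y → Dec (x ⟶ y)) where

  open import Data.List.Membership.DecPropositional _≟_ using (_∈?_)

  _⟶ₛ_ : A → A → Set
  x ⟶ₛ y = y ∈ space × x ⟶ y

  Closed : List A → Set
  Closed R = ∀ {y z} → y ∈ R → z ∈ space → y ⟶ z → z ∈ R

  unvisited : List A → ℕ
  unvisited R = length (filter (λ y → ¬? (y ∈? R)) space)

  saturate : ∀ {x} n R → (∀ {y} → y ∈ R → Star _⟶ₛ_ x y) → x ∈ R → unvisited R < n →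
             Σ (List A) λ R′ → (∀ {y} → y ∈ R′ → Star _⟶ₛ_ x y) × x ∈ R′ × Closed R′
  saturate zero    _ _       _   ()
  saturate (suc n) R reached x∈R bound
    with Any.any? (λ y → Any.any? (λ z → ¬? (z ∈? R) ×-dec y ⟶? z) space) R
  ... | no noExit = R , reached , x∈R , closed
    where
    closed : Closed R
    closed {y} {z} y∈R z∈space y⟶z with z ∈? R
    ... | yes z∈R = z∈R
    ... | no  z∉R = contradiction (lose y∈R (lose z∈space (z∉R , y⟶z))) noExit
  ... | yes exit with find exit
  ...   | y , y∈R , exitAtY with find exitAtY
  ...     | z , z∈space , z∉R , y⟶z =
    saturate n (z ∷ R) reached′ (there x∈R) (<-≤-trans fewer (s≤s⁻¹ bound))
    where
    reached′ : ∀ {w} → w ∈ z ∷ R → Star _⟶ₛ_ _ w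
    reached′ (here refl) = reached y∈R ◅◅ ((z∈space , y⟶z) ◅ ε)
    reached′ (there w∈R) = reached w∈R

    fewer : unvisited (z ∷ R) < unvisited R
    fewer = length-filter-mono-< (λ w → ¬? (w ∈? (z ∷ R))) (λ w → ¬? (w ∈? R)) (_∘ there)
              space z∈space z∉R (λ z∉z∷R → z∉z∷R (here refl))

  Closed-Star : ∀ {R x y} → Closed R → x ∈ R → Star _⟶ₛ_ x y → y ∈ R
  Closed-Star closed x∈R ε                           = x∈R
  Closed-Star closed x∈R ((w∈space , x⟶w) ◅ w⟶⋆y) = Closed-Star closed (closed x∈R w∈space x⟶w) w⟶⋆y

  reachable? : {P : A → Set} → Decidable P → ∀ x → Dec (∃ λ y → Star _⟶ₛ_ x y × P y)
  reachable? P? x with saturate (suc (unvisited (x ∷ []))) (x ∷ []) (λ { (here refl) → ε }) (here refl) ≤-refl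
  ... | R , reached , x∈R , closed = map′ witness search (Any.any? P? R)
    where
    witness : Any _ R → ∃ λ y → Star _⟶ₛ_ x y × _
    witness hit with find hit
    ... | y , y∈R , py = y , reached y∈R , py

    search : (∃ λ y → Star _⟶ₛ_ x y × _) → Any _ R
    search (y , x⟶⋆y , py) = lose (Closed-Star closed x∈R x⟶⋆y) py

CompleteSemSeq? : ∀ F k → Dec (CompleteSemSeq F k)
CompleteSemSeq? F k = map′ fromPath toPath (reachable? (¬? ∘ satisfiable?) ⊤ₛ)
  where
  open FiniteReachability _≟ₛ_ (clauseSetsOver (vars F) k) (SemStep? F k)

  Star⇒SeqFrom : ∀ {G K} → Star _⟶ₛ_ G K → SeqFrom F k G K
  Star⇒SeqFrom ε                                = done
  Star⇒SeqFrom ((_ , isH , cH≤k , G→H) ◅ H⟶⋆K) = step isH cH≤k G→H (Star⇒SeqFrom H⟶⋆K)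

  SeqFrom⇒Star : ∀ {G K} (s : SeqFrom F k G K) → AllStates (Over (vars F)) s → Star _⟶ₛ_ G K
  SeqFrom⇒Star done                   tt                   = ε
  SeqFrom⇒Star (step isH cH≤k G→H s) (overH , overRest) =
    (∈-clauseSetsOver isH cH≤k overH , isH , cH≤k , G→H) ◅ SeqFrom⇒Star s overRest

  fromPath : (∃ λ K → Star _⟶ₛ_ ⊤ₛ K × Unsatisfiable K) → CompleteSemSeq F k
  fromPath (K , path , unsat) = K , Star⇒SeqFrom path , unsat

  toPath : CompleteSemSeq F k → ∃ λ K → Star _⟶ₛ_ ⊤ₛ K × Unsatisfiable K
  toPath (K , s , unsat) with projectOnto (vars F) (Over-vars F) s unsat
  ... | K′ , s′ , over , unsat′ = K′ , SeqFrom⇒Star s′ over , unsat′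

module _ {P : ℕ → Set} (P? : Decidable P) where

  lowest : ∀ n → (∀ {i} → i < n → ¬ P i) ⊎ ∃ λ m → m < n × P m × (∀ {i} → i < m → ¬ P i)
  lowest zero = inj₁ λ ()
  lowest (suc n) with lowest n
  ... | inj₂ (m , m<n , pm , below) = inj₂ (m , m<n⇒m<1+n m<n , pm , below)
  ... | inj₁ none with P? n
  ...   | yes pn = inj₂ (n , n<1+n n , pn , none)
  ...   | no ¬pn = inj₁ λ i<1+n → [ none , (λ { refl → ¬pn }) ]′ (m<1+n⇒m<n∨m≡n i<1+n)

  minimal : ∀ {n} → P n → ∃ λ m → P m × m ≤ n × (∀ {i} → P i → m ≤ i)
  minimal {n} pn with lowest (suc n)
  ... | inj₁ none                     = contradiction pn (none (n<1+n n))
  ... | inj₂ (m , m<1+n , pm , below) = m , pm , s≤s⁻¹ m<1+n , λ pi → ≮⇒≥ (λ i<m → below i<m pi)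

lemma3p3 : (F : List Clause) → IsClauseSet F → Unsatisfiable F →
           (φ : PAss) → (k : ℕ) → IsSS F k →
           Σ ℕ (λ k′ → IsSS (φ * F) k′ × k′ ≤ k)
lemma3p3 F _ _ φ k (seqF , _) with minimal (CompleteSemSeq? (φ * F)) (CompleteSemSeq-* φ seqF)
... | m , seqφF , m≤k , least = m , (seqφF , λ _ → least) , m≤k
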